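{- Let $\mathbf A\in\mathbb V(\mathbf{3_{dblst}},\mathbf{4_{dmba}})$ and $x\in A$. Then $x''\land x'^*=x\land x'^*$.
   Context: Signature $\langle \lor,\land,{}^*,{}',0,1\rangle$. $\mathbb V(\mathbf K)$ is the variety generated by $\mathbf K$. $\mathbf{3_{dblst}}$ is the chain $0<c<1$ with $0^*=1, c^*=0, 1^*=0$ and $0'=1, c'=1, 1'=0$. $\mathbf{4_{dmba}}$ is the four-element Boolean lattice $\{0,a,b,1\}$ with ${}^*$ the Boolean complement ($a^*=b$, $b^*=a$) and $0'=1, 1'=0, a'=a, b'=b$. -}

module Defs where

open import Level using (0ℓ)
open import Data.Product using (Σ; ∃; _×_; _,_; proj₁; proj₂)
open import Data.Bool using (Bool; true; false)
open import Relation.Binary using (IsEquivalence)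
open import Relation.Binary.PropositionalEquality using (_≡_) renaming (isEquivalence to ≡-isEquivalence)

record Alg : Set₁ where
  infixr 6 _∨_
  infixr 7 _∧_
  infix 4 _≈_
  field
    Carrier : Set
    _≈_     : Carrier → Carrier → Set
    isEquivalence : IsEquivalence _≈_
    _∨_ _∧_ : Carrier → Carrier → Carrier
    _* _′   : Carrier → Carrier
    ⊥ ⊤     : Carrier
    ∨-cong : ∀ {x y u v} → x ≈ y → u ≈ v → (x ∨ u) ≈ (y ∨ v)
    ∧-cong : ∀ {x y u v} → x ≈ y → u ≈ v → (x ∧ u) ≈ (y ∧ v)
    *-cong : ∀ {x y} → x ≈ y → (x *) ≈ (y *)
    ′-cong : ∀ {x y} → x ≈ y → (x ′) ≈ (y ′)

mkAlg : (C : Set) → (C → C → C) → (C → C → C) → (C → C) → (C → C) → C → C → Alg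
mkAlg C j m s d b t = record
  { Carrier = C ; _≈_ = _≡_ ; isEquivalence = ≡-isEquivalence
  ; _∨_ = j ; _∧_ = m ; _* = s ; _′ = d ; ⊥ = b ; ⊤ = t
  ; ∨-cong = λ { _≡_.refl _≡_.refl → _≡_.refl }
  ; ∧-cong = λ { _≡_.refl _≡_.refl → _≡_.refl }
  ; *-cong = λ { _≡_.refl → _≡_.refl }
  ; ′-cong = λ { _≡_.refl → _≡_.refl } }

-- 3_dblst : chain 0 < c < 1,  0* = 1, c* = 0, 1* = 0 ; 0' = 1, c' = 1, 1' = 0

data Three : Set where
  z c o : Three

∨3 : Three → Three → Three
∨3 z y = y
∨3 c z = c
∨3 c c = c
∨3 c o = o
∨3 o _ = o

∧3 : Three → Three → Three
∧3 z _ = z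
∧3 c z = z
∧3 c c = c
∧3 c o = c
∧3 o y = y

*3 : Three → Three
*3 z = o
*3 c = z
*3 o = z

′3 : Three → Three
′3 z = o
′3 c = o
′3 o = z

3dblst : Alg
3dblst = mkAlg Three ∨3 ∧3 *3 ′3 z o

-- 4_dmba : Boolean lattice {0,a,b,1}, * Boolean complement,
--          0' = 1, 1' = 0, a' = a, b' = b

data Four : Set where
  f0 fa fb f1 : Four

∨4 : Four → Four → Four
∨4 f0 y = y
∨4 f1 _ = f1
∨4 fa f0 = fa
∨4 fa fa = fa
∨4 fa fb = f1
∨4 fa f1 = f1
∨4 fb f0 = fb
∨4 fb fa = f1
∨4 fb fb = fb
∨4 fb f1 = f1

∧4 : Four → Four → Four
∧4 f0 _ = f0
∧4 f1 y = y
∧4 fa f0 = f0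
∧4 fa fa = fa
∧4 fa fb = f0
∧4 fa f1 = fa
∧4 fb f0 = f0
∧4 fb fa = f0
∧4 fb fb = fb
∧4 fb f1 = fb

*4 : Four → Four
*4 f0 = f1
*4 fa = fb
*4 fb = fa
*4 f1 = f0

′4 : Four → Four
′4 f0 = f1
′4 fa = fa
′4 fb = fb
′4 f1 = f0

4dmba : Alg
4dmba = mkAlg Four ∨4 ∧4 *4 ′4 f0 f1

K : Bool → Alg
K true  = 3dblst
K false = 4dmba

Π : (I : Set) → (I → Alg) → Alg
Π I F = record
  { Carrier = (i : I) → Alg.Carrier (F i)
  ; _≈_ = λ f g → (i : I) → Alg._≈_ (F i) (f i) (g i)
  ; isEquivalence = record
      { refl  = λ {f} i → IsEquivalence.refl (Alg.isEquivalence (F i))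
      ; sym   = λ p i → IsEquivalence.sym (Alg.isEquivalence (F i)) (p i)
      ; trans = λ p q i → IsEquivalence.trans (Alg.isEquivalence (F i)) (p i) (q i) }
  ; _∨_ = λ f g i → Alg._∨_ (F i) (f i) (g i)
  ; _∧_ = λ f g i → Alg._∧_ (F i) (f i) (g i)
  ; _* = λ f i → Alg._* (F i) (f i)
  ; _′ = λ f i → Alg._′ (F i) (f i)
  ; ⊥ = λ i → Alg.⊥ (F i)
  ; ⊤ = λ i → Alg.⊤ (F i)
  ; ∨-cong = λ p q i → Alg.∨-cong (F i) (p i) (q i)
  ; ∧-cong = λ p q i → Alg.∧-cong (F i) (p i) (q i)
  ; *-cong = λ p i → Alg.*-cong (F i) (p i)
  ; ′-cong = λ p i → Alg.′-cong (F i) (p i) }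

record IsSubuniverse (B : Alg) (P : Alg.Carrier B → Set) : Set where
  open Alg B
  field
    ∨-closed : ∀ {x y} → P x → P y → P (x ∨ y)
    ∧-closed : ∀ {x y} → P x → P y → P (x ∧ y)
    *-closed : ∀ {x} → P x → P (x *)
    ′-closed : ∀ {x} → P x → P (x ′)
    ⊥-closed : P ⊥
    ⊤-closed : P ⊤

Sub : (B : Alg) (P : Alg.Carrier B → Set) → IsSubuniverse B P → Alg
Sub B P S = record
  { Carrier = Σ (Alg.Carrier B) P
  ; _≈_ = λ x y → Alg._≈_ B (proj₁ x) (proj₁ y)
  ; isEquivalence = record
      { refl = IsEquivalence.refl (Alg.isEquivalence B)
      ; sym = IsEquivalence.sym (Alg.isEquivalence B)
      ; trans = IsEquivalence.trans (Alg.isEquivalence B) }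
  ; _∨_ = λ x y → Alg._∨_ B (proj₁ x) (proj₁ y) , ∨-closed (proj₂ x) (proj₂ y)
  ; _∧_ = λ x y → Alg._∧_ B (proj₁ x) (proj₁ y) , ∧-closed (proj₂ x) (proj₂ y)
  ; _* = λ x → Alg._* B (proj₁ x) , *-closed (proj₂ x)
  ; _′ = λ x → Alg._′ B (proj₁ x) , ′-closed (proj₂ x)
  ; ⊥ = Alg.⊥ B , ⊥-closed
  ; ⊤ = Alg.⊤ B , ⊤-closed
  ; ∨-cong = Alg.∨-cong B
  ; ∧-cong = Alg.∧-cong B
  ; *-cong = Alg.*-cong B
  ; ′-cong = Alg.′-cong B }
  where open IsSubuniverse S

record IsSurjHom (C A : Alg) (h : Alg.Carrier C → Alg.Carrier A) : Set where
  private
    module C = Alg C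
    module A = Alg A
  field
    h-cong : ∀ {x y} → x C.≈ y → h x A.≈ h y
    h-∨ : ∀ x y → h (x C.∨ y) A.≈ (h x A.∨ h y)
    h-∧ : ∀ x y → h (x C.∧ y) A.≈ (h x A.∧ h y)
    h-* : ∀ x → h (x C.*) A.≈ (h x A.*)
    h-′ : ∀ x → h (x C.′) A.≈ (h x A.′)
    h-⊥ : h C.⊥ A.≈ A.⊥
    h-⊤ : h C.⊤ A.≈ A.⊤
    surj : ∀ a → ∃ λ x → h x A.≈ a

-- A ∈ 𝕍(3_dblst, 4_dmba) = HSP(K): A is a homomorphic image of a
-- subalgebra of a product of copies of 3_dblst and 4_dmba.

record InV (A : Alg) : Set₁ where
  field
    I    : Set
    pick : I → Bool
    P    : Alg.Carrier (Π I (λ i → K (pick i))) → Set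
    sub  : IsSubuniverse (Π I (λ i → K (pick i))) P
    h    : Alg.Carrier (Sub (Π I (λ i → K (pick i))) P sub) → Alg.Carrier A
    hom  : IsSurjHom (Sub (Π I (λ i → K (pick i))) P sub) A h

-- Equations are preserved by products, subalgebras and homomorphic images,
-- so an identity holding in 3_dblst and in 4_dmba holds throughout
-- 𝕍(3_dblst, 4_dmba); in those two finite algebras it is checked by cases.
module Submission where

open import Defs
open import Data.Bool using (Bool; true; false)
open import Data.Product using (_,_; proj₁; proj₂)
open import Data.Unit using (tt) renaming (⊤ to Unit)
open import Relation.Binary using (IsEquivalence)
open import Relation.Binary.PropositionalEquality using (_≡_; refl; cong; cong₂)

infixr 6 _∨ᵗ_
infixr 7 _∧ᵗ_

data Term (X : Set) : Set where
  var           : X → Term X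
  _∨ᵗ_ _∧ᵗ_     : Term X → Term X → Term X
  _*ᵗ _′ᵗ       : Term X → Term X
  ⊥ᵗ ⊤ᵗ         : Term X

module _ {X : Set} where

  eval : (A : Alg) → Term X → (X → Alg.Carrier A) → Alg.Carrier A
  eval A (var x)  ρ = ρ x
  eval A (s ∨ᵗ t) ρ = Alg._∨_ A (eval A s ρ) (eval A t ρ)
  eval A (s ∧ᵗ t) ρ = Alg._∧_ A (eval A s ρ) (eval A t ρ)
  eval A (t *ᵗ)   ρ = Alg._* A (eval A t ρ)
  eval A (t ′ᵗ)   ρ = Alg._′ A (eval A t ρ)
  eval A ⊥ᵗ       ρ = Alg.⊥ A
  eval A ⊤ᵗ       ρ = Alg.⊤ A

  infix 3 _⊨_≈_

  _⊨_≈_ : Alg → Term X → Term X → Set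
  A ⊨ s ≈ t = (ρ : X → Alg.Carrier A) → Alg._≈_ A (eval A s ρ) (eval A t ρ)

  eval-cong : (A : Alg) (t : Term X) {ρ σ : X → Alg.Carrier A} →
              (∀ x → Alg._≈_ A (ρ x) (σ x)) → Alg._≈_ A (eval A t ρ) (eval A t σ)
  eval-cong A (var x)  ρ≈σ = ρ≈σ x
  eval-cong A (s ∨ᵗ t) ρ≈σ = Alg.∨-cong A (eval-cong A s ρ≈σ) (eval-cong A t ρ≈σ)
  eval-cong A (s ∧ᵗ t) ρ≈σ = Alg.∧-cong A (eval-cong A s ρ≈σ) (eval-cong A t ρ≈σ)
  eval-cong A (t *ᵗ)   ρ≈σ = Alg.*-cong A (eval-cong A t ρ≈σ)
  eval-cong A (t ′ᵗ)   ρ≈σ = Alg.′-cong A (eval-cong A t ρ≈σ)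
  eval-cong A ⊥ᵗ       ρ≈σ = IsEquivalence.refl (Alg.isEquivalence A)
  eval-cong A ⊤ᵗ       ρ≈σ = IsEquivalence.refl (Alg.isEquivalence A)

  module _ (I : Set) (F : I → Alg) where

    eval-Π : (t : Term X) (ρ : X → Alg.Carrier (Π I F)) (i : I) →
             eval (Π I F) t ρ i ≡ eval (F i) t (λ x → ρ x i)
    eval-Π (var x)  ρ i = refl
    eval-Π (s ∨ᵗ t) ρ i = cong₂ (Alg._∨_ (F i)) (eval-Π s ρ i) (eval-Π t ρ i)
    eval-Π (s ∧ᵗ t) ρ i = cong₂ (Alg._∧_ (F i)) (eval-Π s ρ i) (eval-Π t ρ i)
    eval-Π (t *ᵗ)   ρ i = cong (Alg._* (F i)) (eval-Π t ρ i)
    eval-Π (t ′ᵗ)   ρ i = cong (Alg._′ (F i)) (eval-Π t ρ i)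
    eval-Π ⊥ᵗ       ρ i = refl
    eval-Π ⊤ᵗ       ρ i = refl

    Π-⊨ : {s t : Term X} → (∀ i → F i ⊨ s ≈ t) → Π I F ⊨ s ≈ t
    Π-⊨ {s} {t} F⊨ ρ i rewrite eval-Π s ρ i | eval-Π t ρ i = F⊨ i (λ x → ρ x i)

  module _ (B : Alg) (P : Alg.Carrier B → Set) (S : IsSubuniverse B P) where

    eval-Sub : (t : Term X) (ρ : X → Alg.Carrier (Sub B P S)) →
               proj₁ (eval (Sub B P S) t ρ) ≡ eval B t (λ x → proj₁ (ρ x))
    eval-Sub (var x)  ρ = refl
    eval-Sub (s ∨ᵗ t) ρ = cong₂ (Alg._∨_ B) (eval-Sub s ρ) (eval-Sub t ρ)
    eval-Sub (s ∧ᵗ t) ρ = cong₂ (Alg._∧_ B) (eval-Sub s ρ) (eval-Sub t ρ)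
    eval-Sub (t *ᵗ)   ρ = cong (Alg._* B) (eval-Sub t ρ)
    eval-Sub (t ′ᵗ)   ρ = cong (Alg._′ B) (eval-Sub t ρ)
    eval-Sub ⊥ᵗ       ρ = refl
    eval-Sub ⊤ᵗ       ρ = refl

    Sub-⊨ : {s t : Term X} → B ⊨ s ≈ t → Sub B P S ⊨ s ≈ t
    Sub-⊨ {s} {t} B⊨ ρ rewrite eval-Sub s ρ | eval-Sub t ρ = B⊨ (λ x → proj₁ (ρ x))

  module _ {C A : Alg} {h : Alg.Carrier C → Alg.Carrier A} (hom : IsSurjHom C A h) where
    open Alg A using (_≈_; ∨-cong; ∧-cong; *-cong; ′-cong)
    open IsEquivalence (Alg.isEquivalence A) renaming (refl to ≈-refl; sym to ≈-sym; trans to ≈-trans)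
    open IsSurjHom hom

    eval-hom : (t : Term X) (ρ : X → Alg.Carrier C) →
               h (eval C t ρ) ≈ eval A t (λ x → h (ρ x))
    eval-hom (var x)  ρ = ≈-refl
    eval-hom (s ∨ᵗ t) ρ = ≈-trans (h-∨ _ _) (∨-cong (eval-hom s ρ) (eval-hom t ρ))
    eval-hom (s ∧ᵗ t) ρ = ≈-trans (h-∧ _ _) (∧-cong (eval-hom s ρ) (eval-hom t ρ))
    eval-hom (t *ᵗ)   ρ = ≈-trans (h-* _) (*-cong (eval-hom t ρ))
    eval-hom (t ′ᵗ)   ρ = ≈-trans (h-′ _) (′-cong (eval-hom t ρ))
    eval-hom ⊥ᵗ       ρ = h-⊥
    eval-hom ⊤ᵗ       ρ = h-⊤

    surjHom-⊨ : {s t : Term X} → C ⊨ s ≈ t → A ⊨ s ≈ t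
    surjHom-⊨ {s} {t} C⊨ ρ =
      ≈-trans (≈-sym (eval-cong A s lifts))
        (≈-trans (≈-sym (eval-hom s ρ̃))
          (≈-trans (h-cong (C⊨ ρ̃))
            (≈-trans (eval-hom t ρ̃) (eval-cong A t lifts))))
      where
      ρ̃ : X → Alg.Carrier C
      ρ̃ x = proj₁ (surj (ρ x))

      lifts : ∀ x → h (ρ̃ x) ≈ ρ x
      lifts x = proj₂ (surj (ρ x))

  V-⊨ : {A : Alg} {s t : Term X} → InV A → (∀ b → K b ⊨ s ≈ t) → A ⊨ s ≈ t
  V-⊨ {s = s} {t} A∈V K⊨ =
    surjHom-⊨ hom {s} {t} (Sub-⊨ _ P sub {s} {t} (Π-⊨ I (λ i → K (pick i)) {s} {t} (λ i → K⊨ (pick i))))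
    where open InV A∈V

x′′∧x′* x∧x′* : Term Unit
x′′∧x′* = var tt ′ᵗ ′ᵗ ∧ᵗ var tt ′ᵗ *ᵗ
x∧x′*   = var tt ∧ᵗ var tt ′ᵗ *ᵗ

3dblst-⊨ : 3dblst ⊨ x′′∧x′* ≈ x∧x′*
3dblst-⊨ ρ with ρ tt
... | z = refl
... | c = refl
... | o = refl

4dmba-⊨ : 4dmba ⊨ x′′∧x′* ≈ x∧x′*
4dmba-⊨ ρ with ρ tt
... | f0 = refl
... | fa = refl
... | fb = refl
... | f1 = refl

K-⊨ : ∀ b → K b ⊨ x′′∧x′* ≈ x∧x′*
K-⊨ true  = 3dblst-⊨
K-⊨ false = 4dmba-⊨

lemma3p6 : (A : Alg) → InV A → (x : Alg.Carrier A) →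
    let open Alg A in
      ((x ′) ′ ∧ (x ′) *) ≈ (x ∧ (x ′) *)
lemma3p6 A A∈V x = V-⊨ {s = x′′∧x′*} {x∧x′*} A∈V K-⊨ (λ _ → x)
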